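{- For all integers $n,d\ge1$: (i) $(\mathrm{bAr}_n|\mathbf{1}_{\mu_n})_{\mu_n}=(\overline{\mathrm{bAr}_n}|\mathbf{1}_{\mu_n})_{\mu_n}=0$; (ii) $\mathrm{bAr}_n+\overline{\mathrm{bAr}_n}=\mathbf{u}_{\mu_n}$; (iii) $\mathrm{bAr}_n=[d]_*\mathrm{bAr}_{nd}$; (iv) $\mathrm{bAr}_{nd}|_{\mu_n}=\mathrm{bAr}_n+\frac{d-1}{2}\mathbf{r}_{\mu_n}$, where $\mathrm{bAr}_{nd}|_{\mu_n}$ is the restriction to the subgroup $\mu_n\subseteq\mu_{nd}$.
   Context: Fix an algebraic closure $\mathbb{Q}^{alg}$ of $\mathbb{Q}$; $\mu_n$ denotes the group of $n$-th roots of unity in $\mathbb{Q}^{alg}$; for $r\in\mathbb{Z}/n\mathbb{Z}$, $\chi_r:\mu_n\to\mu_n$, $\zeta\mapsto\zeta^r$. Define $\mathrm{bAr}_n:=\frac1n\sum_{r=0}^{n-1}r\,\chi_{(r\bmod n)}:\mu_n\to\mathbb{Q}(\mu_n)$. $[d]:\mu_{nd}\to\mu_n$ is $\zeta\mapsto\zeta^d$. For a finite group $G$: $(\chi_1|\chi_2)_G=\frac1{|G|}\sum_g\chi_1(g)\chi_2(g^{ -1})$; $\overline\chi(g)=\chi(g^{ -1})$; $\mathbf{1}_G$, $\mathbf{r}_G$ are the trivial and regular characters, $\mathbf{u}_G=\mathbf{r}_G-\mathbf{1}_G$; for a homomorphism $\alpha:G\to G'$, $\alpha_*\chi$ is the unique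 central function on $G'$ with $(\chi'|\alpha_*\chi)_{G'}=(\chi'\circ\alpha|\chi)_G$ for all central $\chi'$ on $G'$. -}

module Defs where

open import Level using (Level; _⊔_) renaming (suc to lsuc)
open import Data.Nat as ℕ using (ℕ; zero; suc; NonZero; _<_)
open import Data.Nat.Properties using (m*n≢0)
open import Data.Nat.DivMod using (_mod_)
open import Data.Fin as Fin using (Fin; toℕ)
open import Data.Integer as ℤ using (ℤ; +_)
open import Data.Rational as ℚ using (ℚ)
import Data.Rational.Properties as ℚP
open import Data.Product using (Σ; _×_)
open import Relation.Nullary using (¬_)
open import Algebra.Bundles using (CommutativeRing)
open import Algebra.Morphism.Structures using (module RingMorphisms)
import Algebra.Properties.Monoid.Sum as MonoidSum

-- The paper works inside a fixed algebraic
-- closure Q^alg of Q.  We abstract exactly what is used: a field K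
-- (a commutative ring with 1 ≠ 0 in which every nonzero element is
-- invertible) which is a Q-algebra (ring homomorphism ι : ℚ → K, so K
-- has characteristic 0), together with a compatible system of primitive
-- roots of unity ζ N ∈ K (ζ (n*d) ^ d = ζ n), as Q^alg has.  Via
-- k ↦ (ζ n)^k the group μ_n ⊆ K is identified with ℤ/nℤ = Fin n.

module _ {c ℓ : Level} (R : CommutativeRing c ℓ) where
  open CommutativeRing R
  pow : Carrier → ℕ → Carrier
  pow x zero    = 1#
  pow x (suc k) = x * pow x k

record Setting (c ℓ : Level) : Set (lsuc (c ⊔ ℓ)) where
  field
    K : CommutativeRing c ℓ
  open CommutativeRing K public
  field
    1≉0   : ¬ (1# ≈ 0#)
    inv   : ∀ x → ¬ (x ≈ 0#) → Σ Carrier (λ y → x * y ≈ 1#)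
    ι     : ℚ → Carrier
    ι-hom : RingMorphisms.IsRingHomomorphism
              (CommutativeRing.rawRing ℚP.+-*-commutativeRing) rawRing ι

  infixr 8 _^'_
  _^'_ : Carrier → ℕ → Carrier
  _^'_ = pow K

  field
    ζ          : (N : ℕ) → Carrier
    ζ-root     : ∀ N → .{{_ : NonZero N}} → ζ N ^' N ≈ 1#
    ζ-primitive : ∀ N k → 0 < k → k < N → ¬ (ζ N ^' k ≈ 1#)
    ζ-compat   : ∀ n d → .{{_ : NonZero n}} → .{{_ : NonZero d}} →
                 ζ (n ℕ.* d) ^' d ≈ ζ n

module _ {c ℓ : Level} (S : Setting c ℓ) where
  open Setting S
  open MonoidSum +-monoid using (sum)

  -- μ_n, identified with Fin n via k ↦ ζ_n^k; group law is addition mod n.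
  μ : ℕ → Set
  μ n = Fin n

  -- class functions on μ_n with values in K (μ_n is abelian, so every
  -- function is central)
  ClassFun : ℕ → Set c
  ClassFun n = μ n → Carrier

  emb : (n : ℕ) → μ n → Carrier
  emb n k = ζ n ^' toℕ k

  inv-μ : (n : ℕ) .{{_ : NonZero n}} → μ n → μ n
  inv-μ n k = (n ℕ.∸ toℕ k) mod n

  χ : (n : ℕ) → ℕ → ClassFun n
  χ n r k = emb n k ^' r

  bAr : (n : ℕ) .{{_ : NonZero n}} → ClassFun n
  bAr n k = ι (+ 1 ℚ./ n) * sum (λ (r : Fin n) → ι (+ toℕ r ℚ./ 1) * χ n (toℕ r) k)

  ⟨_∣_⟩ : {n : ℕ} .{{_ : NonZero n}} → ClassFun n → ClassFun n → Carrier
  ⟨_∣_⟩ {n} f g = ι (+ 1 ℚ./ n) * sum (λ k → f k * g (inv-μ n k))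

  conj : {n : ℕ} .{{_ : NonZero n}} → ClassFun n → ClassFun n
  conj {n} f k = f (inv-μ n k)

  𝟏 : (n : ℕ) → ClassFun n
  𝟏 n k = 1#

  𝐫 : (n : ℕ) → ClassFun n
  𝐫 n Fin.zero    = ι (+ n ℚ./ 1)
  𝐫 n (Fin.suc k) = 0#

  𝐮 : (n : ℕ) → ClassFun n
  𝐮 n k = 𝐫 n k - 𝟏 n k

  _≋_ : {n : ℕ} → ClassFun n → ClassFun n → Set ℓ
  f ≋ g = ∀ k → f k ≈ g k

  -- [d] : μ_{nd} → μ_n, ζ ↦ ζ^d.  In exponents: ζ_{nd}^k ↦ ζ_{nd}^{kd} = ζ_n^k,
  -- i.e. k ↦ k mod n.
  [_]⟨_⟩ : (d n : ℕ) .{{_ : NonZero n}} → μ (n ℕ.* d) → μ n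
  [ d ]⟨ n ⟩ k = toℕ k mod n

  -- the subgroup inclusion μ_n ⊆ μ_{nd}: ζ_n^k = ζ_{nd}^{dk}
  incl : (n d : ℕ) .{{_ : NonZero n}} .{{_ : NonZero d}} → μ n → μ (n ℕ.* d)
  incl n d k = (d ℕ.* toℕ k) mod (n ℕ.* d)
    where instance _ = m*n≢0 n d

  -- α_* χ is the unique central function on G' with
  -- (χ' | α_* χ)_{G'} = (χ' ∘ α | χ)_G for all central χ' on G'.
  -- "ψ = [d]_* φ" means ψ satisfies this defining property.
  IsPushforward[_] : (d : ℕ) {n : ℕ} .{{_ : NonZero n}} .{{_ : NonZero d}} →
                     ClassFun (n ℕ.* d) → ClassFun n → Set (c ⊔ ℓ)
  IsPushforward[_] d {n} φ ψ =
    ∀ (χ' : ClassFun n) → ⟨ χ' ∣ ψ ⟩ ≈ ⟨ (λ k → χ' ([ d ]⟨ n ⟩ k)) ∣ φ ⟩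
    where instance _ = m*n≢0 n d

  res : (n d : ℕ) .{{_ : NonZero n}} .{{_ : NonZero d}} →
        ClassFun (n ℕ.* d) → ClassFun n
  res n d f k = f (incl n d k)

module Submission where

-- Identify μ_n with ℤ/n via k ↦ ζ_n^k.  Writing x = ζ_n^k we have
-- bAr_n(k) = (1/n) A_n(x) for the weighted power sum A_n(x) = Σ_{r<n} r x^r,
-- so every part of the lemma is an identity between sums of powers of roots
-- of unity.  These are all evaluated with one fact, the orthogonality
-- relation: for 0 < a < n the geometric sum Σ_{k<n} (ζ_n^a)^k vanishes,
-- because ζ_n^a − 1 is invertible in the field K.

open import Defs
open import Level using (Level)
open import Data.Nat as ℕ using (ℕ; NonZero)
open import Data.Nat.Properties using (m*n≢0)
open import Data.Integer as ℤ using (+_)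
open import Data.Rational as ℚ using ()
open import Data.Product using (_×_)

open import Data.Nat using (zero; suc; z≤n; s≤s; _<_; _≤_; _∸_)
import Data.Nat.Properties as ℕP
open import Data.Nat.DivMod
  using (_%_; _/_; _mod_; m≡m%n+[m/n]*n; m<n⇒m%n≡m; n%n≡0; m%n%n≡m%n; [m+kn]%n≡m%n; m∣n⇒o%n%m≡o%m)
open import Data.Nat.Divisibility using (m∣m*n)
open import Data.Nat.Tactic.RingSolver using (solve-∀)
open import Data.Fin as Fin using (Fin; toℕ)
import Data.Fin.Properties as FinP
import Data.Integer.Properties as ℤP
import Data.Integer.Tactic.RingSolver as ℤSolver
open import Data.Rational using (toℚᵘ; 1ℚ)
import Data.Rational.Properties as ℚP
open import Data.Rational.Unnormalised as ℚᵘ using (mkℚᵘ; *≡*; _≃_)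
import Data.Rational.Unnormalised.Properties as ℚᵘP
open import Data.Product using (Σ; _,_; proj₁; proj₂)
open import Relation.Binary.PropositionalEquality as ≡ using (_≡_)
open import Relation.Nullary using (¬_)
open import Algebra.Bundles using (CommutativeSemiring; CommutativeRing)
open import Algebra.Morphism.Structures using (module RingMorphisms)
import Algebra.Properties.Monoid.Sum as MonoidSum
import Algebra.Properties.CommutativeSemigroup as CommutativeSemigroupProperties
import Algebra.Properties.Ring as RingProperties
import Algebra.Solver.Ring.NaturalCoefficients.Default as NaturalSolver
import Relation.Binary.Reasoning.Setoid as SetoidReasoning

-- Sums f 0 + f 1 + … + f (n − 1) over an initial segment of ℕ.  Indexing by ℕ
-- rather than by Fin n keeps the index arithmetic (reversal, blocks i·b + j)
-- in ordinary natural numbers.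
module RangeSums {c ℓ : Level} (R : CommutativeSemiring c ℓ) where
  open CommutativeSemiring R
  open SetoidReasoning setoid
  open CommutativeSemigroupProperties +-commutativeSemigroup using (interchange)

  ∑ : ℕ → (ℕ → Carrier) → Carrier
  ∑ zero    f = 0#
  ∑ (suc n) f = f 0 + ∑ n (λ i → f (suc i))

  infix 5 ∑
  syntax ∑ n (λ i → e) = ∑[ i < n ] e

  ∑-cong : ∀ n {f g : ℕ → Carrier} → (∀ i → i < n → f i ≈ g i) → ∑ n f ≈ ∑ n g
  ∑-cong zero    f≈g = refl
  ∑-cong (suc n) f≈g = +-cong (f≈g 0 (s≤s z≤n)) (∑-cong n (λ i i<n → f≈g (suc i) (s≤s i<n)))

  ∑-congᵖ : ∀ n {f g : ℕ → Carrier} → (∀ i → f i ≈ g i) → ∑ n f ≈ ∑ n g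
  ∑-congᵖ n f≈g = ∑-cong n (λ i _ → f≈g i)

  ∑-length : ∀ {m m'} f → m ≡ m' → ∑ m f ≈ ∑ m' f
  ∑-length f ≡.refl = refl

  ∑-zero : ∀ n → ∑[ i < n ] 0# ≈ 0#
  ∑-zero zero    = refl
  ∑-zero (suc n) = trans (+-identityˡ _) (∑-zero n)

  ∑-+ : ∀ n (f g : ℕ → Carrier) → ∑[ i < n ] (f i + g i) ≈ ∑ n f + ∑ n g
  ∑-+ zero    f g = sym (+-identityˡ 0#)
  ∑-+ (suc n) f g = trans (+-congˡ (∑-+ n _ _)) (interchange _ _ _ _)

  ∑-*ˡ : ∀ n a (f : ℕ → Carrier) → ∑[ i < n ] (a * f i) ≈ a * ∑ n f
  ∑-*ˡ zero    a f = sym (zeroʳ a)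
  ∑-*ˡ (suc n) a f = trans (+-congˡ (∑-*ˡ n a _)) (sym (distribˡ a _ _))

  ∑-*ʳ : ∀ n a (f : ℕ → Carrier) → ∑[ i < n ] (f i * a) ≈ ∑ n f * a
  ∑-*ʳ zero    a f = sym (zeroˡ a)
  ∑-*ʳ (suc n) a f = trans (+-congˡ (∑-*ʳ n a _)) (sym (distribʳ a _ _))

  ∑-last : ∀ n f → ∑ (suc n) f ≈ ∑ n f + f n
  ∑-last zero    f = trans (+-identityʳ _) (sym (+-identityˡ _))
  ∑-last (suc n) f = trans (+-congˡ (∑-last n _)) (sym (+-assoc _ _ _))

  ∑-reverse : ∀ n f → ∑ n f ≈ ∑[ i < n ] f (n ∸ suc i)
  ∑-reverse zero    f = refl
  ∑-reverse (suc n) f = trans (∑-last n f) (trans (+-congʳ (∑-reverse n f)) (+-comm _ _))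

  ∑-split : ∀ m k f → ∑ (m ℕ.+ k) f ≈ ∑ m f + (∑[ i < k ] f (m ℕ.+ i))
  ∑-split zero    k f = sym (+-identityˡ _)
  ∑-split (suc m) k f = trans (+-congˡ (∑-split m k _)) (sym (+-assoc _ _ _))

  ∑-blocks : ∀ a b f → ∑ (a ℕ.* b) f ≈ ∑[ i < a ] ∑[ j < b ] f (i ℕ.* b ℕ.+ j)
  ∑-blocks zero    b f = refl
  ∑-blocks (suc a) b f = trans (∑-split b (a ℕ.* b) f) (+-congˡ (trans (∑-blocks a b _)
    (∑-congᵖ a (λ i → ∑-congᵖ b (λ j → reflexive (≡.cong f (≡.sym (ℕP.+-assoc b (i ℕ.* b) j))))))))

  ∑-swap : ∀ m k (f : ℕ → ℕ → Carrier) → ∑[ i < m ] ∑[ j < k ] f i j ≈ ∑[ j < k ] ∑[ i < m ] f i j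
  ∑-swap zero    k f = sym (∑-zero k)
  ∑-swap (suc m) k f = trans (+-congˡ (∑-swap m k _)) (sym (∑-+ k _ _))

module Powers {c ℓ : Level} (R : CommutativeRing c ℓ) where
  open CommutativeRing R
  open SetoidReasoning setoid
  open RangeSums commutativeSemiring
  open CommutativeSemigroupProperties *-commutativeSemigroup using (interchange)
  open NaturalSolver commutativeSemiring
  open RingProperties ring using (-1*x≈-x; xyx⁻¹≈y)

  infixr 8 _^_
  _^_ : Carrier → ℕ → Carrier
  _^_ = pow R

  ^-cong : ∀ {x y} n → x ≈ y → x ^ n ≈ y ^ n
  ^-cong zero    x≈y = refl
  ^-cong (suc n) x≈y = *-cong x≈y (^-cong n x≈y)

  ^-+ : ∀ x a b → x ^ (a ℕ.+ b) ≈ x ^ a * x ^ b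
  ^-+ x zero    b = sym (*-identityˡ _)
  ^-+ x (suc a) b = trans (*-congˡ (^-+ x a b)) (sym (*-assoc _ _ _))

  1^ : ∀ n → 1# ^ n ≈ 1#
  1^ zero    = refl
  1^ (suc n) = trans (*-identityˡ _) (1^ n)

  *-^ : ∀ x y n → (x * y) ^ n ≈ x ^ n * y ^ n
  *-^ x y zero    = sym (*-identityˡ 1#)
  *-^ x y (suc n) = trans (*-congˡ (*-^ x y n)) (interchange _ _ _ _)

  ^-* : ∀ x a b → x ^ (a ℕ.* b) ≈ (x ^ a) ^ b
  ^-* x zero    b = sym (1^ b)
  ^-* x (suc a) b = trans (^-+ x b (a ℕ.* b)) (trans (*-congˡ (^-* x a b)) (sym (*-^ x (x ^ a) b)))

  ^-comm : ∀ x a b → (x ^ a) ^ b ≈ (x ^ b) ^ a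
  ^-comm x a b = trans (sym (^-* x a b)) (trans (reflexive (≡.cong (x ^_) (ℕP.*-comm a b))) (^-* x b a))

  ^-multiple : ∀ x n → x ^ n ≈ 1# → ∀ t → x ^ (n ℕ.* t) ≈ 1#
  ^-multiple x n xⁿ≈1 t = trans (^-* x n t) (trans (^-cong t xⁿ≈1) (1^ t))

  ^-% : ∀ x n .{{_ : NonZero n}} → x ^ n ≈ 1# → ∀ a → x ^ a ≈ x ^ (a % n)
  ^-% x n xⁿ≈1 a = begin
    x ^ a                               ≈⟨ reflexive (≡.cong (x ^_) (m≡m%n+[m/n]*n a n)) ⟩
    x ^ (a % n ℕ.+ (a / n) ℕ.* n)       ≈⟨ ^-+ x (a % n) _ ⟩
    x ^ (a % n) * x ^ ((a / n) ℕ.* n)   ≈⟨ *-congˡ (trans (reflexive (≡.cong (x ^_) (ℕP.*-comm (a / n) n)))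
                                                          (^-multiple x n xⁿ≈1 (a / n))) ⟩
    x ^ (a % n) * 1#                    ≈⟨ *-identityʳ _ ⟩
    x ^ (a % n)                         ∎

  inverse-^ : ∀ x y n r → y * x ≈ 1# → x ^ n ≈ 1# → r ≤ n → y ^ r ≈ x ^ (n ∸ r)
  inverse-^ x y n r yx≈1 xⁿ≈1 r≤n = begin
    y ^ r                             ≈⟨ sym (*-identityʳ _) ⟩
    y ^ r * 1#                        ≈⟨ *-congˡ (sym (trans (reflexive (≡.cong (x ^_) (ℕP.m+[n∸m]≡n r≤n))) xⁿ≈1)) ⟩
    y ^ r * x ^ (r ℕ.+ (n ∸ r))       ≈⟨ *-congˡ (^-+ x r (n ∸ r)) ⟩
    y ^ r * (x ^ r * x ^ (n ∸ r))     ≈⟨ sym (*-assoc _ _ _) ⟩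
    (y ^ r * x ^ r) * x ^ (n ∸ r)     ≈⟨ *-congʳ (trans (sym (*-^ y x r)) (trans (^-cong r yx≈1) (1^ r))) ⟩
    1# * x ^ (n ∸ r)                  ≈⟨ *-identityˡ _ ⟩
    x ^ (n ∸ r)                       ∎

  -- telescoping, in the subtraction-free form  x·Σ_{i<n} x^i + 1 = Σ_{i<n} x^i + x^n
  geometric-sum : ∀ x n → x * (∑[ i < n ] x ^ i) + 1# ≈ (∑[ i < n ] x ^ i) + x ^ n
  geometric-sum x zero    = +-congʳ (zeroʳ x)
  geometric-sum x (suc n) = begin
    x * (1# + (∑[ i < n ] x * x ^ i)) + 1#   ≈⟨ +-congʳ (*-congˡ (+-congˡ (∑-*ˡ n x (x ^_)))) ⟩
    x * (1# + x * S) + 1#                 ≈⟨ solve 2 (λ x s → x :* (con 1 :+ x :* s) :+ con 1 := x :* (x :* s :+ con 1) :+ con 1) refl x S ⟩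
    x * (x * S + 1#) + 1#                 ≈⟨ +-congʳ (*-congˡ (geometric-sum x n)) ⟩
    x * (S + x ^ n) + 1#                  ≈⟨ solve 3 (λ x s p → x :* (s :+ p) :+ con 1 := (con 1 :+ x :* s) :+ x :* p) refl x S (x ^ n) ⟩
    (1# + x * S) + x * x ^ n              ≈⟨ +-congʳ (+-congˡ (sym (∑-*ˡ n x (x ^_)))) ⟩
    (1# + (∑[ i < n ] x * x ^ i)) + x * x ^ n ∎
    where S = ∑[ i < n ] x ^ i

  geometric-vanish : ∀ x y n → (x - 1#) * y ≈ 1# → x ^ n ≈ 1# → (∑[ i < n ] x ^ i) ≈ 0#
  geometric-vanish x y n unit xⁿ≈1 = begin
    S                            ≈⟨ sym (*-identityˡ S) ⟩
    1# * S                       ≈⟨ *-congʳ (sym unit) ⟩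
    ((x - 1#) * y) * S           ≈⟨ solve 3 (λ a y s → (a :* y) :* s := y :* (a :* s)) refl (x - 1#) y S ⟩
    y * ((x - 1#) * S)           ≈⟨ *-congˡ fixed ⟩
    y * 0#                       ≈⟨ zeroʳ y ⟩
    0#                           ∎
    where
    S = ∑[ i < n ] x ^ i
    xS≈S : x * S ≈ S
    xS≈S = begin
      x * S                ≈⟨ sym (xyx⁻¹≈y 1# (x * S)) ⟩
      1# + x * S - 1#      ≈⟨ +-congʳ (trans (+-comm _ _) (geometric-sum x n)) ⟩
      S + x ^ n - 1#       ≈⟨ +-congʳ (trans (+-congˡ xⁿ≈1) (+-comm _ _)) ⟩
      1# + S - 1#          ≈⟨ xyx⁻¹≈y 1# S ⟩
      S                    ∎
    fixed : (x - 1#) * S ≈ 0#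
    fixed = begin
      (x - 1#) * S         ≈⟨ distribʳ S x (- 1#) ⟩
      x * S + - 1# * S     ≈⟨ +-cong xS≈S (-1*x≈-x S) ⟩
      S - S                ≈⟨ -‿inverseʳ S ⟩
      0#                   ∎

-- Identities in ℚ between fractions i / m, proved by passing to unnormalised
-- rationals, where they become identities between integers.
module RationalIdentities where
  open ℚᵘP.≃-Reasoning

  -- as an unnormalised rational, i / (1 + k) is the pair (i, k)
  toℚᵘ-/ : ∀ i k → toℚᵘ (i ℚ./ suc k) ≃ mkℚᵘ i k
  toℚᵘ-/ i k = ℚP.toℚᵘ-fromℚᵘ (mkℚᵘ i k)

  /1-+ : ∀ x y → (x ℤ.+ y) ℚ./ 1 ≡ x ℚ./ 1 ℚ.+ y ℚ./ 1
  /1-+ x y = ℚP.toℚᵘ-injective (begin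
    toℚᵘ ((x ℤ.+ y) ℚ./ 1)               ≈⟨ toℚᵘ-/ (x ℤ.+ y) 0 ⟩
    mkℚᵘ (x ℤ.+ y) 0                     ≈⟨ *≡* (cross x y) ⟩
    mkℚᵘ x 0 ℚᵘ.+ mkℚᵘ y 0               ≈⟨ ℚᵘP.+-cong (toℚᵘ-/ x 0) (toℚᵘ-/ y 0) ⟨
    toℚᵘ (x ℚ./ 1) ℚᵘ.+ toℚᵘ (y ℚ./ 1)   ≈⟨ ℚP.toℚᵘ-homo-+ (x ℚ./ 1) (y ℚ./ 1) ⟨
    toℚᵘ (x ℚ./ 1 ℚ.+ y ℚ./ 1)           ∎)
    where
    cross : ∀ x y → (x ℤ.+ y) ℤ.* + 1 ≡ (x ℤ.* + 1 ℤ.+ y ℤ.* + 1) ℤ.* + 1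
    cross = ℤSolver.solve-∀

  /1-* : ∀ x y → (x ℤ.* y) ℚ./ 1 ≡ (x ℚ./ 1) ℚ.* (y ℚ./ 1)
  /1-* x y = ℚP.toℚᵘ-injective (begin
    toℚᵘ ((x ℤ.* y) ℚ./ 1)               ≈⟨ toℚᵘ-/ (x ℤ.* y) 0 ⟩
    mkℚᵘ x 0 ℚᵘ.* mkℚᵘ y 0               ≈⟨ ℚᵘP.*-cong (toℚᵘ-/ x 0) (toℚᵘ-/ y 0) ⟨
    toℚᵘ (x ℚ./ 1) ℚᵘ.* toℚᵘ (y ℚ./ 1)   ≈⟨ ℚP.toℚᵘ-homo-* (x ℚ./ 1) (y ℚ./ 1) ⟨
    toℚᵘ ((x ℚ./ 1) ℚ.* (y ℚ./ 1))       ∎)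

  /1-neg : ∀ x → (ℤ.- x) ℚ./ 1 ≡ ℚ.- (x ℚ./ 1)
  /1-neg x = ℚP.toℚᵘ-injective (begin
    toℚᵘ ((ℤ.- x) ℚ./ 1)                 ≈⟨ toℚᵘ-/ (ℤ.- x) 0 ⟩
    ℚᵘ.- mkℚᵘ x 0                        ≈⟨ ℚᵘP.-‿cong (toℚᵘ-/ x 0) ⟨
    ℚᵘ.- toℚᵘ (x ℚ./ 1)                  ≈⟨ ℚP.toℚᵘ-homo‿- (x ℚ./ 1) ⟨
    toℚᵘ (ℚ.- (x ℚ./ 1))                 ∎)

  /1-ℕ+ : ∀ a b → + (a ℕ.+ b) ℚ./ 1 ≡ + a ℚ./ 1 ℚ.+ + b ℚ./ 1
  /1-ℕ+ a b = ≡.trans (≡.cong (ℚ._/ 1) (ℤP.pos-+ a b)) (/1-+ (+ a) (+ b))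

  /1-ℕ* : ∀ a b → + (a ℕ.* b) ℚ./ 1 ≡ (+ a ℚ./ 1) ℚ.* (+ b ℚ./ 1)
  /1-ℕ* a b = ≡.trans (≡.cong (ℚ._/ 1) (ℤP.pos-* a b)) (/1-* (+ a) (+ b))

  1/n*n : ∀ m → (+ 1 ℚ./ suc m) ℚ.* (+ suc m ℚ./ 1) ≡ 1ℚ
  1/n*n m = ℚP.toℚᵘ-injective (begin
    toℚᵘ ((+ 1 ℚ./ suc m) ℚ.* (+ suc m ℚ./ 1))       ≈⟨ ℚP.toℚᵘ-homo-* (+ 1 ℚ./ suc m) (+ suc m ℚ./ 1) ⟩
    toℚᵘ (+ 1 ℚ./ suc m) ℚᵘ.* toℚᵘ (+ suc m ℚ./ 1)   ≈⟨ ℚᵘP.*-cong (toℚᵘ-/ (+ 1) m) (toℚᵘ-/ (+ suc m) 0) ⟩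
    mkℚᵘ (+ 1) m ℚᵘ.* mkℚᵘ (+ suc m) 0               ≈⟨ *≡* (≡.trans (cross (+ suc m)) (≡.cong (+ 1 ℤ.*_) (ℤP.pos-* (suc m) 1))) ⟩
    toℚᵘ 1ℚ                                          ∎)
    where
    cross : ∀ x → (+ 1 ℤ.* x) ℤ.* + 1 ≡ + 1 ℤ.* (x ℤ.* + 1)
    cross = ℤSolver.solve-∀

  1/[m*n] : ∀ m k → + 1 ℚ./ (suc m ℕ.* suc k) ≡ (+ 1 ℚ./ suc m) ℚ.* (+ 1 ℚ./ suc k)
  1/[m*n] m k = ℚP.toℚᵘ-injective (begin
    toℚᵘ (+ 1 ℚ./ (suc m ℕ.* suc k))                 ≈⟨ toℚᵘ-/ (+ 1) (k ℕ.+ m ℕ.* suc k) ⟩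
    mkℚᵘ (+ 1) (k ℕ.+ m ℕ.* suc k)                   ≈⟨ *≡* (cross (+ suc (k ℕ.+ m ℕ.* suc k))) ⟩
    mkℚᵘ (+ 1) m ℚᵘ.* mkℚᵘ (+ 1) k                   ≈⟨ ℚᵘP.*-cong (toℚᵘ-/ (+ 1) m) (toℚᵘ-/ (+ 1) k) ⟨
    toℚᵘ (+ 1 ℚ./ suc m) ℚᵘ.* toℚᵘ (+ 1 ℚ./ suc k)   ≈⟨ ℚP.toℚᵘ-homo-* (+ 1 ℚ./ suc m) (+ 1 ℚ./ suc k) ⟨
    toℚᵘ ((+ 1 ℚ./ suc m) ℚ.* (+ 1 ℚ./ suc k))       ∎)
    where
    cross : ∀ x → + 1 ℤ.* x ≡ (+ 1 ℤ.* + 1) ℤ.* x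
    cross = ℤSolver.solve-∀

  halve : ∀ x → x ℚ./ 2 ≡ (+ 1 ℚ./ 2) ℚ.* (x ℚ./ 1)
  halve x = ℚP.toℚᵘ-injective (begin
    toℚᵘ (x ℚ./ 2)                           ≈⟨ toℚᵘ-/ x 1 ⟩
    mkℚᵘ x 1                                 ≈⟨ *≡* (cross x) ⟩
    mkℚᵘ (+ 1) 1 ℚᵘ.* mkℚᵘ x 0               ≈⟨ ℚᵘP.*-cong (toℚᵘ-/ (+ 1) 1) (toℚᵘ-/ x 0) ⟨
    toℚᵘ (+ 1 ℚ./ 2) ℚᵘ.* toℚᵘ (x ℚ./ 1)     ≈⟨ ℚP.toℚᵘ-homo-* (+ 1 ℚ./ 2) (x ℚ./ 1) ⟨
    toℚᵘ ((+ 1 ℚ./ 2) ℚ.* (x ℚ./ 1))         ∎)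
    where
    cross : ∀ x → x ℤ.* + 2 ≡ (+ 1 ℤ.* x) ℤ.* + 2
    cross = ℤSolver.solve-∀

neg : (n : ℕ) .{{_ : NonZero n}} → ℕ → ℕ
neg n j = (n ∸ j) % n

neg-involutive : ∀ n .{{_ : NonZero n}} j → j < n → neg n (neg n j) ≡ j
neg-involutive n       zero    _   = ≡.trans (≡.cong (λ v → (n ∸ v) % n) (n%n≡0 n)) (n%n≡0 n)
neg-involutive (suc m) (suc j) j<n = begin
  (suc m ∸ (m ∸ j) % suc m) % suc m   ≡⟨ ≡.cong (λ v → (suc m ∸ v) % suc m) (m<n⇒m%n≡m (s≤s (ℕP.m∸n≤m m j))) ⟩
  (suc m ∸ (m ∸ j)) % suc m           ≡⟨ ≡.cong (_% suc m) (ℕP.m∸[m∸n]≡n (ℕP.<⇒≤ j<n)) ⟩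
  suc j % suc m                       ≡⟨ m<n⇒m%n≡m j<n ⟩
  suc j                               ∎
  where open ≡.≡-Reasoning

fibre-complement : ∀ n d t j → t < d → j ≤ n →
                   n ℕ.* d ∸ (t ℕ.* n ℕ.+ j) ≡ (n ∸ j) ℕ.+ (d ∸ suc t) ℕ.* n
fibre-complement n d t j t<d j≤n = begin
  n ℕ.* d ∸ J                        ≡⟨ ≡.cong (_∸ J) whole ⟩
  (n ∸ j) ℕ.+ e ℕ.* n ℕ.+ J ∸ J      ≡⟨ ℕP.m+n∸n≡m ((n ∸ j) ℕ.+ e ℕ.* n) J ⟩
  (n ∸ j) ℕ.+ e ℕ.* n                ∎
  where
  open ≡.≡-Reasoning
  J = t ℕ.* n ℕ.+ j
  e = d ∸ suc t
  expand : ∀ n t e → n ℕ.* (1 ℕ.+ t ℕ.+ e) ≡ n ℕ.+ e ℕ.* n ℕ.+ t ℕ.* n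
  expand = solve-∀
  regroup : ∀ w j e t n → w ℕ.+ j ℕ.+ e ℕ.* n ℕ.+ t ℕ.* n ≡ w ℕ.+ e ℕ.* n ℕ.+ (t ℕ.* n ℕ.+ j)
  regroup = solve-∀
  whole : n ℕ.* d ≡ (n ∸ j) ℕ.+ e ℕ.* n ℕ.+ J
  whole = begin
    n ℕ.* d                                ≡⟨ ≡.cong (n ℕ.*_) (≡.sym (ℕP.m+[n∸m]≡n t<d)) ⟩
    n ℕ.* (suc t ℕ.+ e)                    ≡⟨ expand n t e ⟩
    n ℕ.+ e ℕ.* n ℕ.+ t ℕ.* n              ≡⟨ ≡.cong (λ v → v ℕ.+ e ℕ.* n ℕ.+ t ℕ.* n) (≡.sym (ℕP.m∸n+n≡m j≤n)) ⟩
    (n ∸ j) ℕ.+ j ℕ.+ e ℕ.* n ℕ.+ t ℕ.* n  ≡⟨ regroup (n ∸ j) j e t n ⟩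
    (n ∸ j) ℕ.+ e ℕ.* n ℕ.+ J              ∎

neg-reduce : ∀ n d .{{_ : NonZero n}} .{{_ : NonZero d}} t j → t < d → j ≤ n →
             neg (n ℕ.* d) {{m*n≢0 n d}} (t ℕ.* n ℕ.+ j) % n ≡ neg n j % n
neg-reduce n d t j t<d j≤n = begin
  (n ℕ.* d ∸ J) % (n ℕ.* d) % n        ≡⟨ m∣n⇒o%n%m≡o%m n (n ℕ.* d) (n ℕ.* d ∸ J) (m∣m*n d) ⟩
  (n ℕ.* d ∸ J) % n                    ≡⟨ ≡.cong (_% n) (fibre-complement n d t j t<d j≤n) ⟩
  ((n ∸ j) ℕ.+ (d ∸ suc t) ℕ.* n) % n  ≡⟨ [m+kn]%n≡m%n (n ∸ j) (d ∸ suc t) n ⟩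
  (n ∸ j) % n                          ≡⟨ m%n%n≡m%n (n ∸ j) n ⟨
  (n ∸ j) % n % n                      ∎
  where
  open ≡.≡-Reasoning
  instance _ = m*n≢0 n d
  J = t ℕ.* n ℕ.+ j

mod-cong : ∀ n .{{_ : NonZero n}} {a b} → a % n ≡ b % n → a mod n ≡ b mod n
mod-cong n {a} {b} eq = FinP.fromℕ<-cong (a % n) (b % n) eq _ _

mod-toℕ : ∀ n .{{_ : NonZero n}} (k : Fin n) → toℕ k mod n ≡ k
mod-toℕ n k = ≡.trans (FinP.fromℕ<-cong _ _ (m<n⇒m%n≡m (FinP.toℕ<n k)) _ (FinP.toℕ<n k)) (FinP.fromℕ<-toℕ k _)

module Cyclotomic {c ℓ : Level} (S : Setting c ℓ) where
  open Setting S
  open SetoidReasoning setoid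
  open RangeSums commutativeSemiring
  open Powers K hiding (_^_)
  open NaturalSolver commutativeSemiring
  open CommutativeSemigroupProperties *-commutativeSemigroup using (x∙yz≈y∙xz)
  open RingProperties ring using (x∙y⁻¹≈ε⇒x≈y; //-rightDividesʳ; -‿distribʳ-*)
  open RingMorphisms.IsRingHomomorphism ι-hom using (+-homo; *-homo; -‿homo; 0#-homo; 1#-homo)
  open MonoidSum +-monoid using (sum)
  open RationalIdentities

  +-transpose : ∀ {a b c} → a + b ≈ c → a ≈ c - b
  +-transpose {a} {b} a+b≈c = trans (sym (//-rightDividesʳ b a)) (+-congʳ a+b≈c)

  nat : ℕ → Carrier
  nat r = ι (+ r ℚ./ 1)

  recip : (n : ℕ) .{{_ : NonZero n}} → Carrier
  recip n = ι (+ 1 ℚ./ n)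

  nat-0 : nat 0 ≈ 0#
  nat-0 = 0#-homo

  nat-+ : ∀ a b → nat (a ℕ.+ b) ≈ nat a + nat b
  nat-+ a b = trans (reflexive (≡.cong ι (/1-ℕ+ a b))) (+-homo _ _)

  nat-* : ∀ a b → nat (a ℕ.* b) ≈ nat a * nat b
  nat-* a b = trans (reflexive (≡.cong ι (/1-ℕ* a b))) (*-homo _ _)

  nat-suc : ∀ a → nat (suc a) ≈ 1# + nat a
  nat-suc a = trans (nat-+ 1 a) (+-congʳ 1#-homo)

  recip-nat : ∀ n .{{_ : NonZero n}} → recip n * nat n ≈ 1#
  recip-nat (suc m) = trans (sym (*-homo _ _)) (trans (reflexive (≡.cong ι (1/n*n m))) 1#-homo)

  recip-* : ∀ n d .{{_ : NonZero n}} .{{_ : NonZero d}} → recip (n ℕ.* d) {{m*n≢0 n d}} ≈ recip n * recip d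
  recip-* (suc m) (suc k) = trans (reflexive (≡.cong ι (1/[m*n] m k))) (*-homo _ _)

  recip-*-nat : ∀ n d .{{_ : NonZero n}} .{{_ : NonZero d}} → recip (n ℕ.* d) {{m*n≢0 n d}} * nat d ≈ recip n
  recip-*-nat n d = trans (*-congʳ (recip-* n d)) (trans (*-assoc _ _ _) (trans (*-congˡ (recip-nat d)) (*-identityʳ _)))

  half-pred : ∀ d → ι ((+ d ℤ.- + 1) ℚ./ 2) ≈ recip 2 * (nat d - 1#)
  half-pred d = begin
    ι ((+ d ℤ.- + 1) ℚ./ 2)                 ≈⟨ reflexive (≡.cong ι (halve (+ d ℤ.- + 1))) ⟩
    ι ((+ 1 ℚ./ 2) ℚ.* ((+ d ℤ.- + 1) ℚ./ 1)) ≈⟨ *-homo _ _ ⟩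
    recip 2 * ι ((+ d ℤ.- + 1) ℚ./ 1)       ≈⟨ *-congˡ (trans (reflexive (≡.cong ι (/1-+ (+ d) (ℤ.- + 1)))) (+-homo _ _)) ⟩
    recip 2 * (nat d + ι ((ℤ.- + 1) ℚ./ 1)) ≈⟨ *-congˡ (+-congˡ minus-one) ⟩
    recip 2 * (nat d - 1#)                  ∎
    where
    minus-one : ι ((ℤ.- + 1) ℚ./ 1) ≈ - 1#
    minus-one = trans (reflexive (≡.cong ι (/1-neg (+ 1)))) (trans (-‿homo _) (-‿cong 1#-homo))

  ∑-one : ∀ n → (∑[ i < n ] 1#) ≈ nat n
  ∑-one zero    = sym nat-0
  ∑-one (suc n) = trans (+-congˡ (∑-one n)) (sym (nat-suc n))

  ∑-const : ∀ n a → (∑[ i < n ] a) ≈ nat n * a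
  ∑-const n a = trans (∑-congᵖ n (λ _ → sym (*-identityˡ a))) (trans (∑-*ʳ n a (λ _ → 1#)) (*-congʳ (∑-one n)))

  gauss : ∀ d → (∑[ t < d ] nat t) + (∑[ t < d ] nat t) + nat d ≈ nat d * nat d
  gauss zero    = trans (+-congˡ nat-0) (trans (+-identityʳ _) (trans (+-identityˡ _) (sym (trans (*-congʳ nat-0) (zeroˡ _)))))
  gauss (suc d) = begin
    (∑ (suc d) nat + ∑ (suc d) nat) + nat (suc d) ≈⟨ +-cong (+-cong (∑-last d nat) (∑-last d nat)) (nat-suc d) ⟩
    ((T + a) + (T + a)) + (1# + a)                ≈⟨ solve 3 (λ t a o → ((t :+ a) :+ (t :+ a)) :+ (o :+ a) := ((t :+ t) :+ a) :+ ((a :+ a) :+ o)) refl T a 1# ⟩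
    ((T + T) + a) + ((a + a) + 1#)                ≈⟨ +-congʳ (gauss d) ⟩
    a * a + ((a + a) + 1#)                        ≈⟨ solve 1 (λ a → a :* a :+ ((a :+ a) :+ con 1) := (con 1 :+ a) :* (con 1 :+ a)) refl a ⟩
    (1# + a) * (1# + a)                           ≈⟨ sym (*-cong (nat-suc d) (nat-suc d)) ⟩
    nat (suc d) * nat (suc d)                     ∎
    where
    T = ∑ d nat
    a = nat d

  mean-of-range : ∀ d .{{_ : NonZero d}} → recip d * (∑[ t < d ] nat t) ≈ ι ((+ d ℤ.- + 1) ℚ./ 2)
  mean-of-range d = begin
    recip d * T                            ≈⟨ sym (*-identityˡ _) ⟩
    1# * (recip d * T)                     ≈⟨ *-congʳ (sym (recip-nat 2)) ⟩
    (recip 2 * nat 2) * (recip d * T)      ≈⟨ *-congʳ (*-congˡ (trans (nat-suc 1) (+-congˡ 1#-homo))) ⟩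
    (recip 2 * (1# + 1#)) * (recip d * T)  ≈⟨ solve 3 (λ h i t → (h :* (con 1 :+ con 1)) :* (i :* t) := h :* (i :* (t :+ t))) refl (recip 2) (recip d) T ⟩
    recip 2 * (recip d * (T + T))          ≈⟨ *-congˡ (*-congˡ (+-transpose (gauss d))) ⟩
    recip 2 * (recip d * (a * a - a))      ≈⟨ *-congˡ (distribˡ _ _ _) ⟩
    recip 2 * (recip d * (a * a) + recip d * - a) ≈⟨ *-congˡ (+-cong (trans (sym (*-assoc _ _ _)) (trans (*-congʳ (recip-nat d)) (*-identityˡ _)))
                                                                       (trans (sym (-‿distribʳ-* _ _)) (-‿cong (recip-nat d)))) ⟩
    recip 2 * (a - 1#)                     ≈⟨ sym (half-pred d) ⟩
    ι ((+ d ℤ.- + 1) ℚ./ 2)                ∎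
    where
    T = ∑ d nat
    a = nat d

  root-order : ∀ n .{{_ : NonZero n}} j → (ζ n ^' j) ^' n ≈ 1#
  root-order n j = trans (^-comm (ζ n) j n) (trans (^-cong j (ζ-root n)) (1^ j))

  root-power : ∀ n d .{{_ : NonZero n}} .{{_ : NonZero d}} → ζ (n ℕ.* d) ^' n ≈ ζ d
  root-power n d = ≡.subst (λ N → ζ N ^' n ≈ ζ d) (ℕP.*-comm d n) (ζ-compat d n)

  minus-one-unit : ∀ x → ¬ (x ≈ 1#) → Σ Carrier (λ y → (x - 1#) * y ≈ 1#)
  minus-one-unit x x≉1 = inv (x - 1#) (λ x-1≈0 → x≉1 (x∙y⁻¹≈ε⇒x≈y x 1# x-1≈0))

  root-sum-vanish : ∀ n .{{_ : NonZero n}} a → 0 < a → a < n → (∑[ k < n ] (ζ n ^' a) ^' k) ≈ 0#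
  root-sum-vanish n a 0<a a<n = geometric-vanish (ζ n ^' a) (proj₁ unit) n (proj₂ unit) (root-order n a)
    where unit = minus-one-unit (ζ n ^' a) (ζ-primitive n a 0<a a<n)

  ∑-powers-of-one : ∀ n x → x ≈ 1# → (∑[ k < n ] x ^' k) ≈ nat n
  ∑-powers-of-one n x x≈1 = trans (∑-congᵖ n (λ k → trans (^-cong k x≈1) (1^ k))) (∑-one n)

  character-sum : ∀ n .{{_ : NonZero n}} (k : Fin n) → (∑[ r < n ] (ζ n ^' toℕ k) ^' r) ≈ 𝐫 S n k
  character-sum n Fin.zero      = ∑-powers-of-one n 1# refl
  character-sum n k@(Fin.suc _) = root-sum-vanish n (toℕ k) (s≤s z≤n) (FinP.toℕ<n k)

  inverse-root : ∀ n .{{_ : NonZero n}} j → j ≤ n → ζ n ^' neg n j * ζ n ^' j ≈ 1#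
  inverse-root n j j≤n = begin
    ζ n ^' neg n j * ζ n ^' j        ≈⟨ *-congʳ (^-% (ζ n) n (ζ-root n) (n ∸ j)) ⟨
    ζ n ^' (n ∸ j) * ζ n ^' j        ≈⟨ ^-+ (ζ n) (n ∸ j) j ⟨
    ζ n ^' (n ∸ j ℕ.+ j)             ≈⟨ reflexive (≡.cong (ζ n ^'_) (ℕP.m∸n+n≡m j≤n)) ⟩
    ζ n ^' n                         ≈⟨ ζ-root n ⟩
    1#                               ∎

  -- A class function f on μ_n is represented by f̂ : ℕ → K if f(k) = f̂(k) for
  -- the representatives 0 ≤ k < n; sums and pairings are then sums over ℕ.
  Represents : ∀ {n} → ClassFun S n → (ℕ → Carrier) → Set ℓ
  Represents f f̂ = ∀ k → f k ≈ f̂ (toℕ k)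

  sum-represented : ∀ n (f : ClassFun S n) f̂ → Represents f f̂ → sum f ≈ ∑ n f̂
  sum-represented zero    f f̂ f≈f̂ = refl
  sum-represented (suc n) f f̂ f≈f̂ =
    +-cong (f≈f̂ Fin.zero) (sum-represented n (λ k → f (Fin.suc k)) (λ i → f̂ (suc i)) (λ k → f≈f̂ (Fin.suc k)))

  conj-represented : ∀ n .{{_ : NonZero n}} {f : ClassFun S n} f̂ →
                     Represents f f̂ → Represents (conj S f) (λ j → f̂ (neg n j))
  conj-represented n f̂ f≈f̂ k = trans (f≈f̂ (inv-μ S n k)) (reflexive (≡.cong f̂ (FinP.toℕ-fromℕ< _)))

  ∑-neg : ∀ n .{{_ : NonZero n}} (F : ℕ → Carrier) → (∑[ j < n ] F (neg n j)) ≈ ∑ n F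
  ∑-neg (suc m) F = begin
    ∑[ j < n ] F ((n ∸ j) % n)                  ≈⟨ ∑-reverse n (λ j → F ((n ∸ j) % n)) ⟩
    ∑[ j < n ] F ((n ∸ (n ∸ suc j)) % n)        ≈⟨ ∑-cong n (λ j j<n → reflexive (≡.cong (λ v → F (v % n)) (ℕP.m∸[m∸n]≡n j<n))) ⟩
    ∑[ j < n ] F (suc j % n)                    ≈⟨ ∑-last m _ ⟩
    (∑[ j < m ] F (suc j % n)) + F (n % n)      ≈⟨ +-cong (∑-cong m (λ j j<m → reflexive (≡.cong F (m<n⇒m%n≡m (s≤s j<m)))))
                                                           (reflexive (≡.cong F (n%n≡0 n))) ⟩
    (∑[ j < m ] F (suc j)) + F 0                ≈⟨ +-comm _ _ ⟩
    ∑ n F                                       ∎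
    where n = suc m

  pairing-represented : ∀ n .{{_ : NonZero n}} (f g : ClassFun S n) f̂ ĝ → Represents f f̂ → Represents g ĝ →
                        ⟨_∣_⟩ S f g ≈ recip n * (∑[ j < n ] f̂ (neg n j) * ĝ j)
  pairing-represented n f g f̂ ĝ f≈f̂ g≈ĝ = *-congˡ (begin
    sum (λ k → f k * g (inv-μ S n k))            ≈⟨ sum-represented n _ _ (λ k → *-cong (f≈f̂ k) (conj-represented n ĝ g≈ĝ k)) ⟩
    ∑[ j < n ] f̂ j * ĝ (neg n j)                 ≈⟨ ∑-neg n _ ⟨
    ∑[ j < n ] f̂ (neg n j) * ĝ (neg n (neg n j)) ≈⟨ ∑-cong n (λ j j<n → *-congˡ (reflexive (≡.cong ĝ (neg-involutive n j j<n)))) ⟩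
    ∑[ j < n ] f̂ (neg n j) * ĝ j                 ∎)

  pairing-𝟏 : ∀ n .{{_ : NonZero n}} (f : ClassFun S n) f̂ → Represents f f̂ → ⟨_∣_⟩ S f (𝟏 S n) ≈ recip n * ∑ n f̂
  pairing-𝟏 n f f̂ f≈f̂ = *-congˡ (sum-represented n _ f̂ (λ k → trans (*-identityʳ _) (f≈f̂ k)))

  A : ℕ → Carrier → Carrier
  A n x = ∑[ r < n ] nat r * x ^' r

  A-cong : ∀ n {x y} → x ≈ y → A n x ≈ A n y
  A-cong n x≈y = ∑-congᵖ n (λ r → *-congˡ (^-cong r x≈y))

  bAr-represented : ∀ n .{{_ : NonZero n}} → Represents (bAr S n) (λ j → recip n * A n (ζ n ^' j))
  bAr-represented n k = *-congˡ (sum-represented n _ _ (λ r → refl))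

  -- (i): Σ_j A_n(ζ_n^j) = Σ_r r Σ_j (ζ_n^r)^j = 0 by orthogonality.
  A-sum-over-roots : ∀ n .{{_ : NonZero n}} → (∑[ j < n ] A n (ζ n ^' j)) ≈ 0#
  A-sum-over-roots n = begin
    ∑[ j < n ] ∑[ r < n ] nat r * (ζ n ^' j) ^' r   ≈⟨ ∑-swap n n _ ⟩
    ∑[ r < n ] ∑[ j < n ] nat r * (ζ n ^' j) ^' r   ≈⟨ ∑-cong n column ⟩
    ∑[ r < n ] 0#                                  ≈⟨ ∑-zero n ⟩
    0#                                             ∎
    where
    weighted : ∀ r → r < n → nat r * (∑[ j < n ] (ζ n ^' r) ^' j) ≈ 0#
    weighted zero    _   = trans (*-congʳ nat-0) (zeroˡ _)
    weighted (suc r) r<n = trans (*-congˡ (root-sum-vanish n (suc r) (s≤s z≤n) r<n)) (zeroʳ _)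
    column : ∀ r → r < n → (∑[ j < n ] nat r * (ζ n ^' j) ^' r) ≈ 0#
    column r r<n = trans (∑-*ˡ n (nat r) _) (trans (*-congˡ (∑-congᵖ n (λ j → ^-comm (ζ n) j r))) (weighted r r<n))

  mean-bAr : ∀ n .{{_ : NonZero n}} → (∑[ j < n ] recip n * A n (ζ n ^' j)) ≈ 0#
  mean-bAr n = trans (∑-*ˡ n (recip n) _) (trans (*-congˡ (A-sum-over-roots n)) (zeroʳ _))

  -- (ii): for x^n = 1 with inverse y, reversing r ↦ n − r turns A_n(y) into
  -- Σ_{0<r<n} (n − r) x^r, so that A_n(x) + A_n(y) = n Σ_{0<r<n} x^r.
  A-inverse : ∀ m x y → y * x ≈ 1# → x ^' suc m ≈ 1# →
              A (suc m) x + A (suc m) y ≈ nat (suc m) * (∑[ r < m ] x ^' suc r)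
  A-inverse m x y yx≈1 xⁿ≈1 = begin
    A n x + A n y                                             ≈⟨ +-cong A-at-x A-at-y ⟩
    (∑[ r < m ] nat (suc r) * x ^' suc r) + (∑[ r < m ] nat (m ∸ r) * x ^' suc r)
                                                              ≈⟨ ∑-+ m _ _ ⟨
    ∑[ r < m ] (nat (suc r) * x ^' suc r + nat (m ∸ r) * x ^' suc r)
                                                              ≈⟨ ∑-cong m (λ r r<m → trans (sym (distribʳ _ _ _)) (*-congʳ (weights r r<m))) ⟩
    ∑[ r < m ] nat n * x ^' suc r                             ≈⟨ ∑-*ˡ m (nat n) _ ⟩
    nat n * (∑[ r < m ] x ^' suc r)                           ∎
    where
    n = suc m
    A-at-x : A n x ≈ (∑[ r < m ] nat (suc r) * x ^' suc r)
    A-at-x = trans (+-congʳ (trans (*-congʳ nat-0) (zeroˡ _))) (+-identityˡ _)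
    A-at-y : A n y ≈ (∑[ r < m ] nat (m ∸ r) * x ^' suc r)
    A-at-y = begin
      ∑[ r < n ] nat r * y ^' r                               ≈⟨ ∑-cong n (λ r r<n → *-congˡ {nat r} (inverse-^ x y n r yx≈1 xⁿ≈1 (ℕP.<⇒≤ r<n))) ⟩
      ∑[ r < n ] nat r * x ^' (n ∸ r)                         ≈⟨ ∑-reverse n (λ r → nat r * x ^' (n ∸ r)) ⟩
      ∑[ r < n ] nat (m ∸ r) * x ^' (n ∸ (m ∸ r))             ≈⟨ ∑-cong n (λ r r<n → *-congˡ {nat (m ∸ r)} (reflexive (≡.cong (x ^'_) (ℕP.m∸[m∸n]≡n r<n)))) ⟩
      ∑[ r < n ] nat (m ∸ r) * x ^' suc r                     ≈⟨ ∑-last m _ ⟩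
      (∑[ r < m ] nat (m ∸ r) * x ^' suc r) + nat (m ∸ m) * x ^' n
                                                              ≈⟨ +-congˡ (trans (*-congʳ (trans (reflexive (≡.cong nat (ℕP.n∸n≡0 m))) nat-0)) (zeroˡ _)) ⟩
      (∑[ r < m ] nat (m ∸ r) * x ^' suc r) + 0#              ≈⟨ +-identityʳ _ ⟩
      (∑[ r < m ] nat (m ∸ r) * x ^' suc r)                   ∎
    weights : ∀ r → r < m → nat (suc r) + nat (m ∸ r) ≈ nat n
    weights r r<m = trans (sym (nat-+ (suc r) (m ∸ r))) (reflexive (≡.cong (λ v → nat (suc v)) (ℕP.m+[n∸m]≡n (ℕP.<⇒≤ r<m))))

  -- (iii): summing A_{nd} over the fibre {t n + j : t < d} of [d]; only the
  -- exponents R ≡ 0 (mod d) survive, by orthogonality for ζ_d = ζ_{nd}^n.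
  A-fibre-sum : ∀ n d .{{_ : NonZero n}} .{{_ : NonZero d}} j →
                (∑[ t < d ] A (n ℕ.* d) (ζ (n ℕ.* d) ^' (t ℕ.* n ℕ.+ j))) ≈ (nat d * nat d) * A n (ζ n ^' j)
  A-fibre-sum n d@(suc d') j = begin
    ∑[ t < d ] ∑[ R < nd ] nat R * (Z ^' (t ℕ.* n ℕ.+ j)) ^' R    ≈⟨ ∑-swap d nd (λ t R → nat R * (Z ^' (t ℕ.* n ℕ.+ j)) ^' R) ⟩
    ∑[ R < nd ] ∑[ t < d ] nat R * (Z ^' (t ℕ.* n ℕ.+ j)) ^' R    ≈⟨ ∑-congᵖ nd fibre-term ⟩
    ∑ nd Φ                                                        ≈⟨ ∑-blocks n d Φ ⟩
    ∑[ r < n ] ∑[ s < d ] Φ (r ℕ.* d ℕ.+ s)                       ≈⟨ ∑-congᵖ n block ⟩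
    ∑[ r < n ] (nat d * nat d) * (nat r * x ^' r)                 ≈⟨ ∑-*ˡ n _ _ ⟩
    (nat d * nat d) * A n x                                       ∎
    where
    instance _ = m*n≢0 n d
    nd = n ℕ.* d
    Z = ζ nd
    x = ζ n ^' j
    -- the fibre sum of the R-th term of A_{nd}
    Φ : ℕ → Carrier
    Φ R = nat R * (Z ^' (j ℕ.* R) * (∑[ t < d ] (ζ d ^' R) ^' t))
    exponent : ∀ t n j R → (t ℕ.* n ℕ.+ j) ℕ.* R ≡ j ℕ.* R ℕ.+ n ℕ.* (R ℕ.* t)
    exponent = solve-∀
    power-split : ∀ t R → (Z ^' (t ℕ.* n ℕ.+ j)) ^' R ≈ Z ^' (j ℕ.* R) * (ζ d ^' R) ^' t
    power-split t R = begin
      (Z ^' (t ℕ.* n ℕ.+ j)) ^' R                ≈⟨ ^-* Z (t ℕ.* n ℕ.+ j) R ⟨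
      Z ^' ((t ℕ.* n ℕ.+ j) ℕ.* R)               ≈⟨ reflexive (≡.cong (Z ^'_) (exponent t n j R)) ⟩
      Z ^' (j ℕ.* R ℕ.+ n ℕ.* (R ℕ.* t))         ≈⟨ ^-+ Z (j ℕ.* R) (n ℕ.* (R ℕ.* t)) ⟩
      Z ^' (j ℕ.* R) * Z ^' (n ℕ.* (R ℕ.* t))    ≈⟨ *-congˡ (trans (^-* Z n _) (^-cong (R ℕ.* t) (root-power n d))) ⟩
      Z ^' (j ℕ.* R) * ζ d ^' (R ℕ.* t)          ≈⟨ *-congˡ (^-* (ζ d) R t) ⟩
      Z ^' (j ℕ.* R) * (ζ d ^' R) ^' t           ∎
    fibre-term : ∀ R → (∑[ t < d ] nat R * (Z ^' (t ℕ.* n ℕ.+ j)) ^' R) ≈ Φ R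
    fibre-term R = trans (∑-congᵖ d (λ t → *-congˡ {nat R} (power-split t R)))
                         (trans (∑-*ˡ d (nat R) (λ t → Z ^' (j ℕ.* R) * (ζ d ^' R) ^' t))
                                (*-congˡ (∑-*ˡ d (Z ^' (j ℕ.* R)) (λ t → (ζ d ^' R) ^' t))))
    reduce : ∀ r s → ζ d ^' (r ℕ.* d ℕ.+ s) ≈ ζ d ^' s
    reduce r s = trans (^-+ (ζ d) (r ℕ.* d) s) (trans (*-congʳ multiple) (*-identityˡ _))
      where multiple = trans (reflexive (≡.cong (ζ d ^'_) (ℕP.*-comm r d))) (^-multiple (ζ d) d (ζ-root d) r)
    diagonal-exponent : ∀ j r d → j ℕ.* (r ℕ.* d ℕ.+ 0) ≡ d ℕ.* (j ℕ.* r)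
    diagonal-exponent = solve-∀
    diagonal : ∀ r → Φ (r ℕ.* d ℕ.+ 0) ≈ (nat d * nat d) * (nat r * x ^' r)
    diagonal r = begin
      Φ (r ℕ.* d ℕ.+ 0)                        ≈⟨ *-cong weight (*-cong root-part full-sum) ⟩
      (nat r * nat d) * (x ^' r * nat d)       ≈⟨ solve 3 (λ a e y → (a :* e) :* (y :* e) := (e :* e) :* (a :* y)) refl (nat r) (nat d) (x ^' r) ⟩
      (nat d * nat d) * (nat r * x ^' r)       ∎
      where
      weight = trans (reflexive (≡.cong nat (ℕP.+-identityʳ (r ℕ.* d)))) (nat-* r d)
      root-part = trans (reflexive (≡.cong (Z ^'_) (diagonal-exponent j r d)))
                        (trans (^-* Z d (j ℕ.* r)) (trans (^-cong (j ℕ.* r) (ζ-compat n d)) (^-* (ζ n) j r)))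
      full-sum = ∑-powers-of-one d _ (reduce r 0)
    off-diagonal : ∀ r s → s < d' → Φ (r ℕ.* d ℕ.+ suc s) ≈ 0#
    off-diagonal r s s<d' = trans (*-congˡ (trans (*-congˡ vanish) (zeroʳ _))) (zeroʳ _)
      where vanish = trans (∑-congᵖ d (λ t → ^-cong t (reduce r (suc s)))) (root-sum-vanish d (suc s) (s≤s z≤n) (s≤s s<d'))
    block : ∀ r → (∑[ s < d ] Φ (r ℕ.* d ℕ.+ s)) ≈ (nat d * nat d) * (nat r * x ^' r)
    block r = trans (+-cong (diagonal r) (trans (∑-cong d' (off-diagonal r)) (∑-zero d'))) (+-identityʳ _)

  pushforward-criterion : ∀ n d .{{_ : NonZero n}} .{{_ : NonZero d}}
                          (φ : ClassFun S (n ℕ.* d)) (ψ : ClassFun S n) φ̂ ψ̂ →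
                          Represents φ φ̂ → Represents ψ ψ̂ →
                          (∀ j → j < n → (∑[ t < d ] φ̂ (t ℕ.* n ℕ.+ j)) ≈ nat d * ψ̂ j) →
                          IsPushforward[_] S d φ ψ
  pushforward-criterion n d φ ψ φ̂ ψ̂ φ≈φ̂ ψ≈ψ̂ fibre χ' = begin
    ⟨_∣_⟩ S χ' ψ                                              ≈⟨ pairing-represented n χ' ψ ĉ ψ̂ ĉ-represents ψ≈ψ̂ ⟩
    recip n * (∑[ j < n ] ĉ (neg n j) * ψ̂ j)                  ≈⟨ *-congʳ (recip-*-nat n d) ⟨
    (recip nd * nat d) * (∑[ j < n ] ĉ (neg n j) * ψ̂ j)       ≈⟨ *-assoc _ _ _ ⟩
    recip nd * (nat d * (∑[ j < n ] ĉ (neg n j) * ψ̂ j))       ≈⟨ *-congˡ (∑-*ˡ n (nat d) _) ⟨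
    recip nd * (∑[ j < n ] nat d * (ĉ (neg n j) * ψ̂ j))       ≈⟨ *-congˡ regroup ⟨
    recip nd * (∑[ J < nd ] ĉ (neg nd J) * φ̂ J)               ≈⟨ pairing-represented nd _ φ ĉ φ̂ (λ _ → refl) φ≈φ̂ ⟨
    ⟨_∣_⟩ S (λ h → χ' ([_]⟨_⟩ S d n h)) φ                     ∎
    where
    instance _ = m*n≢0 n d
    nd = n ℕ.* d
    ĉ : ℕ → Carrier
    ĉ a = χ' (a mod n)
    ĉ-represents : Represents χ' ĉ
    ĉ-represents k = reflexive (≡.cong χ' (≡.sym (mod-toℕ n k)))
    -- the summands of ⟨χ' ∘ [d] | φ⟩ after the pairing is written over ℕ
    G : ℕ → Carrier
    G J = ĉ (neg nd J) * φ̂ J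
    fibre-of : ∀ j → j < n → (∑[ t < d ] G (t ℕ.* n ℕ.+ j)) ≈ nat d * (ĉ (neg n j) * ψ̂ j)
    fibre-of j j<n = begin
      ∑[ t < d ] G (t ℕ.* n ℕ.+ j)                   ≈⟨ ∑-cong d (λ t t<d → *-congʳ (same-residue t t<d)) ⟩
      ∑[ t < d ] ĉ (neg n j) * φ̂ (t ℕ.* n ℕ.+ j)     ≈⟨ ∑-*ˡ d _ _ ⟩
      ĉ (neg n j) * (∑[ t < d ] φ̂ (t ℕ.* n ℕ.+ j))   ≈⟨ *-congˡ (fibre j j<n) ⟩
      ĉ (neg n j) * (nat d * ψ̂ j)                    ≈⟨ x∙yz≈y∙xz _ _ _ ⟩
      nat d * (ĉ (neg n j) * ψ̂ j)                    ∎
      where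
      same-residue : ∀ t → t < d → ĉ (neg nd (t ℕ.* n ℕ.+ j)) ≈ ĉ (neg n j)
      same-residue t t<d = reflexive (≡.cong χ' (mod-cong n (neg-reduce n d t j t<d (ℕP.<⇒≤ j<n))))
    regroup : ∑ nd G ≈ (∑[ j < n ] nat d * (ĉ (neg n j) * ψ̂ j))
    regroup = begin
      ∑ nd G                                         ≈⟨ ∑-length G (ℕP.*-comm n d) ⟩
      ∑ (d ℕ.* n) G                                  ≈⟨ ∑-blocks d n G ⟩
      ∑[ t < d ] ∑[ j < n ] G (t ℕ.* n ℕ.+ j)        ≈⟨ ∑-swap d n _ ⟩
      ∑[ j < n ] ∑[ t < d ] G (t ℕ.* n ℕ.+ j)        ≈⟨ ∑-cong n fibre-of ⟩
      ∑[ j < n ] nat d * (ĉ (neg n j) * ψ̂ j)         ∎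

  -- (iv): writing R = t n + r, for x^n = 1 the R-th term of A_{nd}(x) is
  -- t (n x^r) + r x^r; summing over t < d and r < n gives
  -- A_{nd}(x) = (Σ_{t<d} t) n Σ_{r<n} x^r + d A_n(x).
  A-periodic : ∀ n d x → x ^' n ≈ 1# →
               A (n ℕ.* d) x ≈ (∑[ t < d ] nat t) * (nat n * (∑[ r < n ] x ^' r)) + nat d * A n x
  A-periodic n d x xⁿ≈1 = begin
    A (n ℕ.* d) x                                                ≈⟨ ∑-length (λ R → nat R * x ^' R) (ℕP.*-comm n d) ⟩
    ∑[ R < d ℕ.* n ] nat R * x ^' R                              ≈⟨ ∑-blocks d n (λ R → nat R * x ^' R) ⟩
    ∑[ t < d ] ∑[ r < n ] nat (t ℕ.* n ℕ.+ r) * x ^' (t ℕ.* n ℕ.+ r)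
                                                                 ≈⟨ ∑-swap d n (λ t r → nat (t ℕ.* n ℕ.+ r) * x ^' (t ℕ.* n ℕ.+ r)) ⟩
    ∑[ r < n ] ∑[ t < d ] nat (t ℕ.* n ℕ.+ r) * x ^' (t ℕ.* n ℕ.+ r)
                                                                 ≈⟨ ∑-congᵖ n column ⟩
    ∑[ r < n ] (T * (nat n * x ^' r) + nat d * (nat r * x ^' r)) ≈⟨ ∑-+ n _ _ ⟩
    (∑[ r < n ] T * (nat n * x ^' r)) + (∑[ r < n ] nat d * (nat r * x ^' r))
                                                                 ≈⟨ +-cong (trans (∑-*ˡ n T _) (*-congˡ (∑-*ˡ n (nat n) _))) (∑-*ˡ n (nat d) _) ⟩
    T * (nat n * (∑[ r < n ] x ^' r)) + nat d * A n x            ∎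
    where
    T = ∑ d nat
    term : ∀ r t → nat (t ℕ.* n ℕ.+ r) * x ^' (t ℕ.* n ℕ.+ r) ≈ nat t * (nat n * x ^' r) + nat r * x ^' r
    term r t = begin
      nat (t ℕ.* n ℕ.+ r) * x ^' (t ℕ.* n ℕ.+ r)   ≈⟨ *-cong (trans (nat-+ (t ℕ.* n) r) (+-congʳ (nat-* t n))) (^-+ x (t ℕ.* n) r) ⟩
      (nat t * nat n + nat r) * (x ^' (t ℕ.* n) * x ^' r)
                                                  ≈⟨ *-congˡ (*-congʳ (trans (reflexive (≡.cong (x ^'_) (ℕP.*-comm t n))) (^-multiple x n xⁿ≈1 t))) ⟩
      (nat t * nat n + nat r) * (1# * x ^' r)     ≈⟨ solve 4 (λ a b e y → (a :* b :+ e) :* (con 1 :* y) := a :* (b :* y) :+ e :* y) refl (nat t) (nat n) (nat r) (x ^' r) ⟩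
      nat t * (nat n * x ^' r) + nat r * x ^' r   ∎
    column : ∀ r → (∑[ t < d ] nat (t ℕ.* n ℕ.+ r) * x ^' (t ℕ.* n ℕ.+ r)) ≈ T * (nat n * x ^' r) + nat d * (nat r * x ^' r)
    column r = trans (∑-congᵖ d (term r)) (trans (∑-+ d _ _) (+-cong (∑-*ʳ d _ nat) (∑-const d _)))

  incl-root : ∀ n d .{{_ : NonZero n}} .{{_ : NonZero d}} (k : Fin n) →
              ζ (n ℕ.* d) ^' toℕ (incl S n d k) ≈ ζ n ^' toℕ k
  incl-root n d k = begin
    Z ^' toℕ (incl S n d k)       ≈⟨ reflexive (≡.cong (Z ^'_) (FinP.toℕ-fromℕ< {m = (d ℕ.* toℕ k) % nd} {n = nd} _)) ⟩
    Z ^' ((d ℕ.* toℕ k) % nd)     ≈⟨ ^-% Z nd (ζ-root nd) (d ℕ.* toℕ k) ⟨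
    Z ^' (d ℕ.* toℕ k)            ≈⟨ ^-* Z d (toℕ k) ⟩
    (Z ^' d) ^' toℕ k             ≈⟨ ^-cong (toℕ k) (ζ-compat n d) ⟩
    ζ n ^' toℕ k                  ∎
    where
    instance _ = m*n≢0 n d
    nd = n ℕ.* d
    Z = ζ nd

  -- (i): ⟨bAr_n | 1⟩ and ⟨bAr̄_n | 1⟩ are both the mean value of bAr_n,
  -- since inversion permutes μ_n.
  part-i : ∀ n .{{_ : NonZero n}} →
           (⟨_∣_⟩ S (bAr S n) (𝟏 S n) ≈ 0#) × (⟨_∣_⟩ S (conj S (bAr S n)) (𝟏 S n) ≈ 0#)
  part-i n = vanish (pairing-𝟏 n _ b̂ (bAr-represented n))
           , vanish (trans (pairing-𝟏 n _ (λ j → b̂ (neg n j)) (conj-represented n b̂ (bAr-represented n)))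
                           (*-congˡ (∑-neg n b̂)))
    where
    b̂ : ℕ → Carrier
    b̂ j = recip n * A n (ζ n ^' j)
    vanish : ∀ {z} → z ≈ recip n * ∑ n b̂ → z ≈ 0#
    vanish z≈mean = trans z≈mean (trans (*-congˡ (mean-bAr n)) (zeroʳ _))

  -- (ii): (1/n)(A_n(x) + A_n(x⁻¹)) = Σ_{0<r<n} x^r = 𝐫_n(x) − 1.
  part-ii : ∀ n .{{_ : NonZero n}} → _≋_ S (λ k → bAr S n k + conj S (bAr S n) k) (𝐮 S n)
  part-ii n@(suc m) k = begin
    bAr S n k + conj S (bAr S n) k        ≈⟨ +-cong (bAr-represented n k) (conj-represented n b̂ (bAr-represented n) k) ⟩
    recip n * A n x + recip n * A n y     ≈⟨ distribˡ _ _ _ ⟨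
    recip n * (A n x + A n y)             ≈⟨ *-congˡ (A-inverse m x y (inverse-root n j (ℕP.<⇒≤ (FinP.toℕ<n k))) (root-order n j)) ⟩
    recip n * (nat n * P)                 ≈⟨ *-assoc _ _ _ ⟨
    (recip n * nat n) * P                 ≈⟨ trans (*-congʳ (recip-nat n)) (*-identityˡ P) ⟩
    P                                     ≈⟨ +-transpose (trans (+-comm P 1#) (character-sum n k)) ⟩
    𝐮 S n k                               ∎
    where
    b̂ : ℕ → Carrier
    b̂ i = recip n * A n (ζ n ^' i)
    j = toℕ k
    x = ζ n ^' j
    y = ζ n ^' neg n j
    P = ∑[ r < m ] x ^' suc r

  -- (iii): the fibre sums of bAr_{nd} are d · bAr_n.
  part-iii : ∀ n d .{{_ : NonZero n}} .{{_ : NonZero d}} →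
             IsPushforward[_] S d (bAr S (n ℕ.* d) {{m*n≢0 n d}}) (bAr S n)
  part-iii n d = pushforward-criterion n d _ _ (λ J → recip nd * A nd (ζ nd ^' J)) (λ j → recip n * A n (ζ n ^' j))
                                       (bAr-represented nd) (bAr-represented n) fibre
    where
    instance _ = m*n≢0 n d
    nd = n ℕ.* d
    fibre : ∀ j → j < n → (∑[ t < d ] recip nd * A nd (ζ nd ^' (t ℕ.* n ℕ.+ j))) ≈ nat d * (recip n * A n (ζ n ^' j))
    fibre j _ = begin
      ∑[ t < d ] recip nd * A nd (ζ nd ^' (t ℕ.* n ℕ.+ j))     ≈⟨ ∑-*ˡ d (recip nd) _ ⟩
      recip nd * (∑[ t < d ] A nd (ζ nd ^' (t ℕ.* n ℕ.+ j)))   ≈⟨ *-congˡ (A-fibre-sum n d j) ⟩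
      recip nd * ((nat d * nat d) * a)                         ≈⟨ solve 3 (λ i e a → i :* ((e :* e) :* a) := e :* ((i :* e) :* a)) refl (recip nd) (nat d) a ⟩
      nat d * ((recip nd * nat d) * a)                         ≈⟨ *-congˡ (*-congʳ (recip-*-nat n d)) ⟩
      nat d * (recip n * a)                                    ∎
      where a = A n (ζ n ^' j)

  part-iv : ∀ n d .{{_ : NonZero n}} .{{_ : NonZero d}} →
            _≋_ S (res S n d (bAr S (n ℕ.* d) {{m*n≢0 n d}}))
                  (λ k → bAr S n k + ι ((+ d ℤ.- + 1) ℚ./ 2) * 𝐫 S n k)
  part-iv n d k = begin
    bAr S nd (incl S n d k)                                   ≈⟨ bAr-represented nd (incl S n d k) ⟩
    recip nd * A nd (ζ nd ^' toℕ (incl S n d k))              ≈⟨ *-congˡ (A-cong nd (incl-root n d k)) ⟩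
    recip nd * A nd x                                         ≈⟨ *-congˡ (A-periodic n d x (root-order n (toℕ k))) ⟩
    recip nd * (T * (nat n * X) + nat d * A n x)              ≈⟨ *-congʳ (recip-* n d) ⟩
    (recip n * recip d) * (T * (nat n * X) + nat d * A n x)   ≈⟨ solve 7 (λ i j t m y e w → (i :* j) :* (t :* (m :* y) :+ e :* w)
                                                                             := (i :* m) :* ((j :* t) :* y) :+ (j :* e) :* (i :* w))
                                                                      refl (recip n) (recip d) T (nat n) X (nat d) (A n x) ⟩
    (recip n * nat n) * ((recip d * T) * X) + (recip d * nat d) * (recip n * A n x)
                                                              ≈⟨ +-cong (trans (*-congʳ (recip-nat n)) (*-identityˡ _))
                                                                        (trans (*-congʳ (recip-nat d)) (*-identityˡ _)) ⟩
    (recip d * T) * X + recip n * A n x                       ≈⟨ +-comm _ _ ⟩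
    recip n * A n x + (recip d * T) * X                       ≈⟨ +-cong (sym (bAr-represented n k)) (*-cong (mean-of-range d) (character-sum n k)) ⟩
    bAr S n k + ι ((+ d ℤ.- + 1) ℚ./ 2) * 𝐫 S n k             ∎
    where
    instance _ = m*n≢0 n d
    nd = n ℕ.* d
    x = ζ n ^' toℕ k
    T = ∑ d nat
    X = ∑[ r < n ] x ^' r

lemma3p2 : ∀ {c ℓ : Level} (S : Setting c ℓ) (n d : ℕ) .{{_ : NonZero n}} .{{_ : NonZero d}} →
    let open Setting S
        instance nd≢0 = m*n≢0 n d
    in ((⟨_∣_⟩ S (bAr S n) (𝟏 S n) ≈ 0#) × (⟨_∣_⟩ S (conj S (bAr S n)) (𝟏 S n) ≈ 0#))
       × _≋_ S (λ k → bAr S n k + conj S (bAr S n) k) (𝐮 S n)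
       × IsPushforward[_] S d (bAr S (n ℕ.* d)) (bAr S n)
       × _≋_ S (res S n d (bAr S (n ℕ.* d)))
               (λ k → bAr S n k + ι ((+ d ℤ.- + 1) ℚ./ 2) * 𝐫 S n k)
lemma3p2 S n d = part-i n , part-ii n , part-iii n d , part-iv n d
  where open Cyclotomic S
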